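{- Let $\Pi,\pi_1,\dots,\pi_D,\Pi_1,\dots,\Pi_D$ be set partitions of $\{1,\dots,n\}$ such that $\Pi\ge\Pi_c$ and $\pi_c\ge\Pi_c$ for every $c$. Then the graph $G[\Pi,\{\pi_c\}_c;\{\Pi_c\}_c]$ has exactly $|\Pi\vee\pi_1\vee\cdots\vee\pi_D|$ connected components.
   Context: $\le$ is refinement of set partitions, $\vee$ the join, $|\cdot|$ the number of blocks. $G[\Pi,\{\pi_c\}_c;\{\Pi_c\}_c]$ is the bipartite multigraph with one white vertex for each block of $\Pi$, one vertex of color $c$ for each block of $\pi_c$ ($c=1,\dots,D$), and, for each $c$ and each block $b_c$ of $\Pi_c$, one edge joining the block of $\Pi$ containing $b_c$ to the block of $\pi_c$ containing $b_c$. -}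

module Defs where

open import Data.Nat using (ℕ)
open import Data.Fin using (Fin)
open import Data.Product using (Σ; ∃; _×_; _,_)
open import Data.Sum using (_⊎_; inj₁; inj₂)
open import Relation.Binary.PropositionalEquality using (_≡_)
open import Relation.Binary.Construct.Closure.ReflexiveTransitive using (Star)
open import Function.Bundles using (_⇔_)

-- A set partition of {1,…,n} (= Fin n), presented by its blocks:
-- the blocks are numbered 0,…,blocks-1 (blocks = |P|), label i is the
-- block containing i, and every block is nonempty.
record Partition (n : ℕ) : Set where
  field
    blocks : ℕ
    label  : Fin n → Fin blocks
    nonempty : ∀ (b : Fin blocks) → ∃ λ i → label i ≡ b
open Partition public

∣_∣ₚ : ∀ {n} → Partition n → ℕ
∣ P ∣ₚ = blocks P

SameBlock : ∀ {n} → Partition n → Fin n → Fin n → Set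
SameBlock P i j = label P i ≡ label P j

_≤ₚ_ : ∀ {n} → Partition n → Partition n → Set
P ≤ₚ Q = ∀ i j → SameBlock P i j → SameBlock Q i j

-- "the equivalence relation R on A has exactly k classes":
-- the classes are in bijection with Fin k, i.e. there is a surjection
-- f : A → Fin k whose fibres are exactly the R-classes.
HasClasses : {A : Set} → (A → A → Set) → ℕ → Set
HasClasses {A} R k =
  Σ (A → Fin k) λ f →
    (∀ (b : Fin k) → ∃ λ x → f x ≡ b) ×
    (∀ x y → (f x ≡ f y) ⇔ R x y)

-- The join Π ∨ π₁ ∨ … ∨ π_D, given by its equivalence relation: the
-- equivalence relation generated by the union of the block relations.
JoinRel : ∀ {n D} → Partition n → (Fin D → Partition n) → Fin n → Fin n → Set
JoinRel Π π = Star (λ i j → SameBlock Π i j ⊎ ∃ λ c → SameBlock (π c) i j)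

JoinHasBlocks : ∀ {n D} → Partition n → (Fin D → Partition n) → ℕ → Set
JoinHasBlocks Π π k = HasClasses (JoinRel Π π) k

-- Vertices of G[Π,{π_c};{Π_c}]: white vertices = blocks of Π,
-- vertices of colour c = blocks of π_c.
Vertex : ∀ {n D} → Partition n → (Fin D → Partition n) → Set
Vertex Π π = Fin (blocks Π) ⊎ Σ (Fin _) (λ c → Fin (blocks (π c)))

-- Edges: for each colour c and each block b of Π_c, an edge joining the
-- block of Π containing b to the block of π_c containing b (well defined
-- under the refinement hypotheses; we take any element i of b).
-- Edge u v holds iff there is at least one such edge between u and v
-- (multiplicities are irrelevant for connectivity).
Edge : ∀ {n D} (Π : Partition n) (π Πc : Fin D → Partition n) →
       Vertex Π π → Vertex Π π → Set
Edge {D = D} Π π Πc u v =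
  ∃ λ (c : Fin D) → ∃ λ (b : Fin (blocks (Πc c))) → ∃ λ i →
    label (Πc c) i ≡ b × u ≡ inj₁ (label Π i) × v ≡ inj₂ (c , label (π c) i)

Connected : ∀ {n D} (Π : Partition n) (π Πc : Fin D → Partition n) →
            Vertex Π π → Vertex Π π → Set
Connected Π π Πc = Star (λ u v → Edge Π π Πc u v ⊎ Edge Π π Πc v u)

HasComponents : ∀ {n D} (Π : Partition n) (π Πc : Fin D → Partition n) → ℕ → Set
HasComponents Π π Πc k = HasClasses (Connected Π π Πc) k

-- The white vertex of block(Π, i) and a chosen element of each block translate the two
-- equivalence relations into each other: Π-steps are equalities of white vertices, a
-- π_c-step from i to j is the path white i — π_c(i) — white j, and an edge of the graph
-- is a Π-step followed by a π_c-step between representatives. Translations of relations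
-- that are mutually inverse up to the relations induce a bijection of classes.
module Submission where

open import Defs
open import Data.Nat using (ℕ)
open import Data.Fin using (Fin)
open import Data.Product using (∃; _,_; proj₁; proj₂)
open import Data.Sum using (_⊎_; inj₁; inj₂)
open import Function.Base using (_∘_)
open import Function.Bundles using (_⇔_; mk⇔; Equivalence)
open import Level using (0ℓ)
open import Relation.Binary.Core using (Rel; _=[_]⇒_)
open import Relation.Binary.Definitions using (Symmetric; Transitive)
open import Relation.Binary.PropositionalEquality as ≡ using (_≡_; refl; cong; subst)
open import Relation.Binary.Construct.Closure.ReflexiveTransitive
  using (ε; _◅_; _◅◅_; reverse; kleisliStar)

HasClasses-pullback : ∀ {A B : Set} {R : Rel A 0ℓ} {S : Rel B 0ℓ} →
  Symmetric R → Transitive R →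
  (φ : A → B) (ψ : B → A) → R =[ φ ]⇒ S → S =[ ψ ]⇒ R →
  (∀ x → R x (ψ (φ x))) → (∀ v → S v (φ (ψ v))) →
  ∀ {k} → HasClasses S k → HasClasses R k
HasClasses-pullback {R = R} {S = S}
  R-sym R-trans φ ψ φ-resp ψ-resp R-unit S-unit (f , f-surj , f-fibres) =
  f ∘ φ , surjective , fibres
  where
  f-resp : ∀ {u v} → S u v → f u ≡ f v
  f-resp {u} {v} = Equivalence.from (f-fibres u v)

  surjective : ∀ b → ∃ λ x → f (φ x) ≡ b
  surjective b with f-surj b
  ... | v , fv≡b = ψ v , ≡.trans (≡.sym (f-resp (S-unit v))) fv≡b

  fibres : ∀ x y → (f (φ x) ≡ f (φ y)) ⇔ R x y
  fibres x y = mk⇔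
    (λ eq → R-trans (R-unit x) (R-trans (ψ-resp (Equivalence.to (f-fibres _ _) eq)) (R-sym (R-unit y))))
    (f-resp ∘ φ-resp)

module Translation {n D : ℕ} (Π : Partition n) (π Πc : Fin D → Partition n) where

  private
    Join = JoinRel Π π
    Conn = Connected Π π Πc

  white : Fin n → Vertex Π π
  white i = inj₁ (label Π i)

  representative : Vertex Π π → Fin n
  representative (inj₁ b)       = proj₁ (nonempty Π b)
  representative (inj₂ (c , b)) = proj₁ (nonempty (π c) b)

  JoinRel-sym : Symmetric Join
  JoinRel-sym = reverse λ { (inj₁ e) → inj₁ (≡.sym e) ; (inj₂ (c , e)) → inj₂ (c , ≡.sym e) }

  Connected-sym : Symmetric Conn
  Connected-sym = reverse λ { (inj₁ e) → inj₂ e ; (inj₂ e) → inj₁ e }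

  edge-through : ∀ c i → Edge Π π Πc (white i) (inj₂ (c , label (π c) i))
  edge-through c i = c , label (Πc c) i , i , refl , refl , refl

  join-step⇒connected : ∀ {i j} → SameBlock Π i j ⊎ ∃ (λ c → SameBlock (π c) i j) →
                        Conn (white i) (white j)
  join-step⇒connected {i} (inj₁ e) = subst (Conn (white i) ∘ inj₁) e ε
  join-step⇒connected {i} {j} (inj₂ (c , e)) =
    inj₁ (edge-through c i) ◅ inj₂ (c , _ , j , refl , refl , cong (λ b → inj₂ (c , b)) e) ◅ ε

  edge⇒join : ∀ {u v} → Edge Π π Πc u v → Join (representative u) (representative v)
  edge⇒join (c , _ , i , _ , refl , refl) =
    inj₁ (proj₂ (nonempty Π (label Π i))) ◅
    inj₂ (c , ≡.sym (proj₂ (nonempty (π c) (label (π c) i)))) ◅ ε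

  join-unit : ∀ i → Join i (representative (white i))
  join-unit i = inj₁ (≡.sym (proj₂ (nonempty Π (label Π i)))) ◅ ε

  connected-unit : ∀ v → Conn v (white (representative v))
  connected-unit (inj₁ b) with nonempty Π b
  ... | _ , refl = ε
  connected-unit (inj₂ (c , b)) with nonempty (π c) b
  ... | i , refl = inj₂ (edge-through c i) ◅ ε

  join⇒connected : Join =[ white ]⇒ Conn
  join⇒connected = kleisliStar white join-step⇒connected

  connected⇒join : Conn =[ representative ]⇒ Join
  connected⇒join = kleisliStar representative
    λ { (inj₁ e) → edge⇒join e ; (inj₂ e) → JoinRel-sym (edge⇒join e) }

lemma4p2 : ∀ (n D : ℕ) (Π : Partition n) (π Πc : Fin D → Partition n) →
    (∀ c → Πc c ≤ₚ Π) → (∀ c → Πc c ≤ₚ π c) →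
    ∀ (k : ℕ) → HasComponents Π π Πc k ⇔ JoinHasBlocks Π π k
lemma4p2 n D Π π Πc _ _ k = mk⇔
  (HasClasses-pullback JoinRel-sym _◅◅_ white representative
    join⇒connected connected⇒join join-unit connected-unit)
  (HasClasses-pullback Connected-sym _◅◅_ representative white
    connected⇒join join⇒connected connected-unit join-unit)
  where open Translation Π π Πc
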